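{- Let $G$ and $H$ be graphs, each of order at least $2$. Then: (i) for any $k\in\{1,\ldots,\mathcal{C}(G+H)\}$, $\operatorname{adim}_k(G+H)\ge\operatorname{adim}_k(G)+\operatorname{adim}_k(H)$; (ii) for any $k\in\{1,\ldots,\min\{\mathcal{C}(H),\mathcal{C}(K_1+G)\}\}$, $\operatorname{adim}_k(G+H)\le\operatorname{adim}_k(K_1+G)+\operatorname{adim}_k(H)$.
   Context: All graphs are finite and simple. The join $G+H$ of vertex-disjoint graphs $G,H$ has vertex set $V(G)\cup V(H)$ and edge set $E(G)\cup E(H)\cup\{uv:u\in V(G),v\in V(H)\}$; $K_1$ is the one-vertex graph. For a graph $G=(V,E)$, $d_{G,2}(x,y)=\min\{d_G(x,y),2\}$ with $d_G$ the shortest-path distance ($\infty$ between different components). For distinct $x,y$, $\mathcal{C}_G(x,y)=\{z\in V: d_{G,2}(x,z)\ne d_{G,2}(y,z)\}$, $\mathcal{C}(G)=\min_{x\ne y}|\mathcal{C}_G(x,y)|$. A set $S\subseteq V$ is a $k$-adjacency generator if $|S\cap\mathcal{C}_G(x,y)|\ge k$ for all distinct $x,y$; $\operatorname{adim}_k(G)$ is the minimum cardinality of such a set. -}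

module Defs where

open import Data.Bool using (Bool; true; false; T; not; if_then_else_)
open import Data.Nat using (ℕ; zero; suc; _+_; _≤_; _≤?_; _⊓_)
open import Data.Fin using (Fin; splitAt; _≟_)
open import Data.Fin.Properties using (all?)
open import Data.Fin.Subset using (Subset; _∩_; ∣_∣)
open import Data.Sum using (_⊎_; inj₁; inj₂)
open import Data.Vec using (Vec; []; _∷_; tabulate)
open import Data.List using (List; []; _∷_; concatMap; map; foldr; filter; allFin)
open import Relation.Nullary using (¬_; Dec; does; ¬?)
open import Relation.Nullary.Decidable using (_→-dec_)
open import Relation.Binary.PropositionalEquality using (_≡_; _≢_; refl)
import Data.Nat as ℕ

record Graph (n : ℕ) : Set where
  field
    adj    : Fin n → Fin n → Bool
    sym    : ∀ x y → adj x y ≡ adj y x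
    irrefl : ∀ x → adj x x ≡ false
open Graph public

K₁ : Graph 1
K₁ = record { adj = λ _ _ → false ; sym = λ _ _ → refl ; irrefl = λ _ → refl }

-- Join G + H : vertices of G come first (via splitAt).
private
  jadj : ∀ {m n} → Graph m → Graph n → Fin m ⊎ Fin n → Fin m ⊎ Fin n → Bool
  jadj G H (inj₁ x) (inj₁ y) = adj G x y
  jadj G H (inj₂ x) (inj₂ y) = adj H x y
  jadj G H (inj₁ x) (inj₂ y) = true
  jadj G H (inj₂ x) (inj₁ y) = true

  jsym : ∀ {m n} (G : Graph m) (H : Graph n) u v → jadj G H u v ≡ jadj G H v u
  jsym G H (inj₁ x) (inj₁ y) = sym G x y
  jsym G H (inj₂ x) (inj₂ y) = sym H x y
  jsym G H (inj₁ x) (inj₂ y) = refl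
  jsym G H (inj₂ x) (inj₁ y) = refl

  jirr : ∀ {m n} (G : Graph m) (H : Graph n) u → jadj G H u u ≡ false
  jirr G H (inj₁ x) = irrefl G x
  jirr G H (inj₂ x) = irrefl H x

_⊹_ : ∀ {m n} → Graph m → Graph n → Graph (m + n)
_⊹_ {m} G H = record
  { adj    = λ x y → jadj G H (splitAt m x) (splitAt m y)
  ; sym    = λ x y → jsym G H (splitAt m x) (splitAt m y)
  ; irrefl = λ x → jirr G H (splitAt m x) }

-- d_{G,2}(x,y) = min (d_G(x,y)) 2 : 0 if x = y, 1 if adjacent, 2 otherwise
-- (this covers the case d = ∞ between different components).
d₂ : ∀ {n} → Graph n → Fin n → Fin n → ℕ
d₂ G x y = if does (x ≟ y) then 0 else (if adj G x y then 1 else 2)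

𝒞 : ∀ {n} → Graph n → Fin n → Fin n → Subset n
𝒞 G x y = tabulate (λ z → not (does (d₂ G x z ℕ.≟ d₂ G y z)))

-- 𝒞(G) = min over distinct x y of |𝒞_G(x,y)|.
-- (The fold starts at n, which is ≥ every |𝒞_G(x,y)|, so for n ≥ 2 this is the exact minimum.)
𝒞min : ∀ {n} → Graph n → ℕ
𝒞min {n} G =
  foldr _⊓_ n
    (concatMap (λ x → concatMap (λ y →
       if does (x ≟ y) then [] else (∣ 𝒞 G x y ∣ ∷ [])) (allFin n)) (allFin n))

IsAdjGen : ∀ {n} → ℕ → Graph n → Subset n → Set
IsAdjGen k G S = ∀ x y → x ≢ y → k ≤ ∣ S ∩ 𝒞 G x y ∣

isAdjGen? : ∀ {n} k (G : Graph n) S → Dec (IsAdjGen k G S)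
isAdjGen? k G S = all? (λ x → all? (λ y → ¬? (x ≟ y) →-dec (k ≤? ∣ S ∩ 𝒞 G x y ∣)))

allSubsets : ∀ n → List (Subset n)
allSubsets zero    = [] ∷ []
allSubsets (suc n) = concatMap (λ s → (true ∷ s) ∷ (false ∷ s) ∷ []) (allSubsets n)

-- adim_k(G): minimum cardinality of a k-adjacency generator.
-- (The fold starts at suc n, a value attained only when no generator exists.)
adim : ∀ {n} → ℕ → Graph n → ℕ
adim {n} k G =
  foldr _⊓_ (suc n) (map ∣_∣ (filter (isAdjGen? k G) (allSubsets n)))

module Submission where

-- In G + H every vertex of G is adjacent to every vertex of H, so two vertices of G are separated
-- by vertices of G only, and likewise for H: a k-adjacency generator of G + H splits into
-- k-adjacency generators of G and of H, which gives (i).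
-- For (ii) take optimal generators S₁ of K₁ + G and S₂ of H. A vertex z of G separates x ∈ G from
-- y ∈ H in G + H exactly when it separates x from the apex in K₁ + G, so S₁ minus the apex and S₂
-- together handle every pair except that the apex itself may be missing as a separator of mixed
-- pairs. Its place is taken inside H: either some z ∈ S₂ is not a neighbour of y, or y is adjacent
-- to all of S₂; as S₂ is a 1-adjacency generator there is at most one such y, and adding it costs no
-- more than the dropped apex.

open import Defs hiding (sym)
open import Data.Bool using (Bool; true; false; T; not; _∧_; _∨_; if_then_else_)
open import Data.Bool.Properties using (∧-zeroʳ; ∧-identityʳ; T-∧; T-∨; T-not-≡)
open import Data.Empty using (⊥-elim)
open import Data.Fin using (Fin; zero; suc; _↑ˡ_; _↑ʳ_; splitAt; _≟_)
open import Data.Fin.Properties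
  using (↑ˡ-injective; ↑ʳ-injective; splitAt-↑ˡ; splitAt-↑ʳ; splitAt⁻¹-↑ˡ; splitAt⁻¹-↑ʳ;
         suc-injective; all?; ¬∀⟶∃¬)
open import Data.Fin.Subset using (Subset; _∩_; ∣_∣; ⊤)
open import Data.Fin.Subset.Properties using (∣p∣≤n; ∩-identityˡ)
open import Data.List using (List; []; _∷_; foldr; map; filter)
open import Data.List.Membership.Propositional using (_∈_; lose)
open import Data.List.Membership.Propositional.Properties
  using (∈-map⁺; ∈-map⁻; ∈-filter⁺; ∈-filter⁻; ∈-concatMap⁺; ∈-allFin; foldr-selective)
open import Data.List.Relation.Unary.Any using (here; there)
open import Data.Nat using (ℕ; zero; suc; _+_; _≤_; _⊓_; _≡ᵇ_; z≤n; s≤s)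
open import Data.Nat.Properties
  using (≤-reflexive; ≤-trans; <-irrefl; n≤1+n; m≤n⇒m≤1+n; m≤m+n; ⊓-sel; m⊓n≤m; m⊓n≤n;
         +-comm; +-assoc; +-suc; +-identityʳ; +-mono-≤; +-monoʳ-≤; +-monoˡ-≤; module ≤-Reasoning)
import Data.Nat.Properties as ℕ
open import Data.Product using (_×_; _,_; ∃-syntax; proj₂)
open import Data.Sum using (inj₁; inj₂; [_,_]′)
open import Data.Vec using ([]; _∷_; lookup; tabulate)
open import Data.Vec.Properties using (lookup∘tabulate; lookup-zipWith)
open import Function using (_∘_; Equivalence)
open import Relation.Nullary using (¬_; Dec; yes; no; does; contradiction)
open import Relation.Nullary.Decidable
  using (T?; _→-dec_; isYes; dec-true; dec-false; toWitness; fromWitness; decidable-stable)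
open import Relation.Binary.PropositionalEquality
  using (_≡_; _≢_; refl; sym; trans; cong; cong₂; subst)

open Equivalence using (to; from)

private variable
  m n k : ℕ

boolToℕ : Bool → ℕ
boolToℕ true  = 1
boolToℕ false = 0

count : (Fin n → Bool) → ℕ
count {zero}  f = 0
count {suc n} f = boolToℕ (f zero) + count (f ∘ suc)

count-cong : {f g : Fin n → Bool} → (∀ i → f i ≡ g i) → count f ≡ count g
count-cong {zero}  f≗g = refl
count-cong {suc n} f≗g = cong₂ _+_ (cong boolToℕ (f≗g zero)) (count-cong (f≗g ∘ suc))

count-mono : {f g : Fin n → Bool} → (∀ i → T (f i) → T (g i)) → count f ≤ count g
count-mono {zero}          f⇒g = z≤n
count-mono {suc n} {f} {g} f⇒g with f zero | g zero | f⇒g zero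
... | false | false | _ = count-mono (f⇒g ∘ suc)
... | false | true  | _ = m≤n⇒m≤1+n (count-mono (f⇒g ∘ suc))
... | true  | true  | _ = s≤s (count-mono (f⇒g ∘ suc))
... | true  | false | h = ⊥-elim (h _)

count-≡0 : {f : Fin n → Bool} → (∀ i → ¬ T (f i)) → count f ≡ 0
count-≡0 {zero}      _  = refl
count-≡0 {suc n} {f} ¬f with f zero | ¬f zero
... | false | _  = count-≡0 (¬f ∘ suc)
... | true  | ¬t = ⊥-elim (¬t _)

count-pos : {f : Fin n → Bool} (i : Fin n) → T (f i) → 1 ≤ count f
count-pos {f = f} zero    t with f zero | t
... | true | _ = s≤s z≤n
count-pos {f = f} (suc i) t with f zero
... | true  = s≤s z≤n
... | false = count-pos i t

count-≤1 : {f : Fin n → Bool} → (∀ i j → T (f i) → T (f j) → i ≡ j) → count f ≤ 1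
count-≤1 {zero}      _      = z≤n
count-≤1 {suc n} {f} unique with f zero in f₀
... | false = count-≤1 λ i j s t → suc-injective (unique (suc i) (suc j) s t)
... | true  = s≤s (≤-reflexive (count-≡0 λ i t → 0≢suc (unique zero (suc i) (subst T (sym f₀) _) t)))
  where
    0≢suc : ∀ {i : Fin n} → zero ≢ suc i
    0≢suc ()

count-∨ : (f g : Fin n → Bool) → count (λ i → f i ∨ g i) ≤ count f + count g
count-∨ {zero}  f g = z≤n
count-∨ {suc n} f g = step (f zero) (g zero) (count-∨ (f ∘ suc) (g ∘ suc))
  where
    step : ∀ b c {x a y} → x ≤ a + y → boolToℕ (b ∨ c) + x ≤ (boolToℕ b + a) + (boolToℕ c + y)
    step true  true  {a = a} x≤ = s≤s (≤-trans x≤ (+-monoʳ-≤ a (n≤1+n _)))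
    step true  false         x≤ = s≤s x≤
    step false true  {a = a} x≤ = ≤-trans (s≤s x≤) (≤-reflexive (sym (+-suc a _)))
    step false false         x≤ = x≤

count-∧ˡ : ∀ b {f : Fin n → Bool} → (T b → count f ≤ 1) → count (λ i → b ∧ f i) ≤ boolToℕ b
count-∧ˡ false {f} _ = ≤-reflexive (count-≡0 {f = λ i → false ∧ f i} λ _ ())
count-∧ˡ true  h = h _

count-+ : ∀ m {n} (f : Fin (m + n) → Bool) → count f ≡ count (f ∘ (_↑ˡ n)) + count (f ∘ (m ↑ʳ_))
count-+ zero    f = refl
count-+ (suc m) {n} f = trans (cong (boolToℕ (f zero) +_) (count-+ m (f ∘ suc)))
                             (sym (+-assoc (boolToℕ (f zero)) _ _))

_⊕_ : (Fin m → Bool) → (Fin n → Bool) → Fin (m + n) → Bool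
_⊕_ {m} f g X = [ f , g ]′ (splitAt m X)

⊕-↑ˡ : (f : Fin m → Bool) (g : Fin n → Bool) (i : Fin m) → (f ⊕ g) (i ↑ˡ n) ≡ f i
⊕-↑ˡ {m} {n} f g i = cong [ f , g ]′ (splitAt-↑ˡ m i n)

⊕-↑ʳ : (f : Fin m → Bool) (g : Fin n → Bool) (j : Fin n) → (f ⊕ g) (m ↑ʳ j) ≡ g j
⊕-↑ʳ {m} {n} f g j = cong [ f , g ]′ (splitAt-↑ʳ m n j)

count-⊕ : (f : Fin m → Bool) (g : Fin n → Bool) → count (f ⊕ g) ≡ count f + count g
count-⊕ {m} f g = trans (count-+ m (f ⊕ g)) (cong₂ _+_ (count-cong (⊕-↑ˡ f g)) (count-cong (⊕-↑ʳ f g)))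

∣∣≡count : (S : Subset n) → ∣ S ∣ ≡ count (lookup S)
∣∣≡count []          = refl
∣∣≡count (true  ∷ S) = cong suc (∣∣≡count S)
∣∣≡count (false ∷ S) = ∣∣≡count S

∣tabulate∣≡count : (f : Fin n → Bool) → ∣ tabulate f ∣ ≡ count f
∣tabulate∣≡count f = trans (∣∣≡count (tabulate f)) (count-cong (lookup∘tabulate f))

-- Adjacency generators as Boolean vertex predicates

infix 4 _≢ᵇ_
_≢ᵇ_ : ℕ → ℕ → Bool
p ≢ᵇ q = not (p ≡ᵇ q)

separates : Graph n → Fin n → Fin n → Fin n → Bool
separates G x y z = d₂ G x z ≢ᵇ d₂ G y z

IsAdjGenᶠ : ℕ → Graph n → (Fin n → Bool) → Set
IsAdjGenᶠ k G s = ∀ x y → x ≢ y → k ≤ count (λ z → s z ∧ separates G x y z)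

∣∩𝒞∣≡count : (S : Subset n) (G : Graph n) (x y : Fin n) →
             ∣ S ∩ 𝒞 G x y ∣ ≡ count (λ z → lookup S z ∧ separates G x y z)
∣∩𝒞∣≡count S G x y = trans (∣∣≡count (S ∩ 𝒞 G x y)) (count-cong λ z →
  trans (lookup-zipWith _∧_ z S (𝒞 G x y)) (cong (lookup S z ∧_) (lookup∘tabulate _ z)))

isAdjGen⇒isAdjGenᶠ : {G : Graph n} {S : Subset n} → IsAdjGen k G S → IsAdjGenᶠ k G (lookup S)
isAdjGen⇒isAdjGenᶠ {G = G} {S} gen x y x≢y = subst (_ ≤_) (∣∩𝒞∣≡count S G x y) (gen x y x≢y)

isAdjGenᶠ⇒isAdjGen : {G : Graph n} {s : Fin n → Bool} → IsAdjGenᶠ k G s → IsAdjGen k G (tabulate s)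
isAdjGenᶠ⇒isAdjGen {G = G} {s} gen x y x≢y =
  subst (_ ≤_) (sym (trans (∣∩𝒞∣≡count (tabulate s) G x y)
                           (count-cong λ z → cong (_∧ separates G x y z) (lookup∘tabulate s z))))
        (gen x y x≢y)

isAdjGenᶠ-mono : (G : Graph n) {s t : Fin n → Bool} →
                 (∀ i → T (s i) → T (t i)) → IsAdjGenᶠ k G s → IsAdjGenᶠ k G t
isAdjGenᶠ-mono G s⇒t gen x y x≢y =
  ≤-trans (gen x y x≢y) (count-mono λ z sz∧ →
    let (sz , sep) = to T-∧ sz∧ in from T-∧ (s⇒t z sz , sep))

-- adim as an attained minimum

foldr-⊓-≤ : ∀ {d x} {xs : List ℕ} → x ∈ xs → foldr _⊓_ d xs ≤ x
foldr-⊓-≤ {xs = y ∷ _} (here refl) = m⊓n≤m y _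
foldr-⊓-≤ {xs = y ∷ _} (there x∈) = ≤-trans (m⊓n≤n y _) (foldr-⊓-≤ x∈)

∈-allSubsets : (S : Subset n) → S ∈ allSubsets n
∈-allSubsets []          = here refl
∈-allSubsets (true  ∷ S) = ∈-concatMap⁺ _ (lose (∈-allSubsets S) (here refl))
∈-allSubsets (false ∷ S) = ∈-concatMap⁺ _ (lose (∈-allSubsets S) (there (here refl)))

adim-≤ : (G : Graph n) (S : Subset n) → IsAdjGen k G S → adim k G ≤ ∣ S ∣
adim-≤ {k = k} G S gen = foldr-⊓-≤ (∈-map⁺ ∣_∣ (∈-filter⁺ (isAdjGen? k G) (∈-allSubsets S) gen))

adim-≤-count : (G : Graph n) {s : Fin n → Bool} → IsAdjGenᶠ k G s → adim k G ≤ count s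
adim-≤-count G {s} gen =
  subst (_ ≤_) (∣tabulate∣≡count s) (adim-≤ G (tabulate s) (isAdjGenᶠ⇒isAdjGen {G = G} gen))

𝒞min-≤ : (G : Graph n) {x y : Fin n} → x ≢ y → 𝒞min G ≤ ∣ 𝒞 G x y ∣
𝒞min-≤ G {x} {y} x≢y =
  foldr-⊓-≤ (∈-concatMap⁺ _ (lose (∈-allFin x) (∈-concatMap⁺ _ (lose (∈-allFin y) ∣𝒞∣∈))))
  where
    ∣𝒞∣∈ : ∣ 𝒞 G x y ∣ ∈ (if does (x ≟ y) then [] else (∣ 𝒞 G x y ∣ ∷ []))
    ∣𝒞∣∈ rewrite dec-false (x ≟ y) x≢y = here refl

⊤-isAdjGen : (G : Graph n) → k ≤ 𝒞min G → IsAdjGen k G ⊤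
⊤-isAdjGen G k≤𝒞 x y x≢y =
  subst (_ ≤_) (sym (cong ∣_∣ (∩-identityˡ (𝒞 G x y)))) (≤-trans k≤𝒞 (𝒞min-≤ G x≢y))

adim-attained : (G : Graph n) → k ≤ 𝒞min G → ∃[ s ] IsAdjGenᶠ k G s × count s ≡ adim k G
adim-attained {n} {k} G k≤𝒞
  with foldr-selective ⊓-sel (suc n) (map ∣_∣ (filter (isAdjGen? k G) (allSubsets n)))
... | inj₁ adim≡1+n = ⊥-elim (<-irrefl refl (subst (_≤ n) adim≡1+n adim≤n))
  where
    adim≤n : adim k G ≤ n
    adim≤n = ≤-trans (adim-≤ G ⊤ (⊤-isAdjGen G k≤𝒞)) (∣p∣≤n (⊤ {n}))
... | inj₂ adim∈ with ∈-map⁻ ∣_∣ adim∈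
...   | S , S∈ , adim≡∣S∣ =
  lookup S , isAdjGen⇒isAdjGenᶠ {G = G} {S} (proj₂ (∈-filter⁻ (isAdjGen? k G) {xs = allSubsets n} S∈))
           , trans (sym (∣∣≡count S)) (sym adim≡∣S∣)

-- d₂ in a join

d₂-self : (G : Graph n) (x : Fin n) → d₂ G x x ≡ 0
d₂-self G x rewrite dec-true (x ≟ x) refl = refl

d₂-≢ : (G : Graph n) {x y : Fin n} → x ≢ y → d₂ G x y ≡ (if adj G x y then 1 else 2)
d₂-≢ G {x} {y} x≢y rewrite dec-false (x ≟ y) x≢y = refl

d₂-embedding : (G : Graph m) (G′ : Graph n) (f : Fin m → Fin n) →
               (∀ {x y} → f x ≡ f y → x ≡ y) → (∀ x y → adj G′ (f x) (f y) ≡ adj G x y) →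
               ∀ x y → d₂ G′ (f x) (f y) ≡ d₂ G x y
d₂-embedding G G′ f f-inj adj-f x y with x ≟ y
... | yes refl = d₂-self G′ (f x)
... | no  x≢y  = trans (d₂-≢ G′ (x≢y ∘ f-inj)) (cong (if_then 1 else 2) (adj-f x y))

≢ᵇ-sym : ∀ p q → (p ≢ᵇ q) ≡ (q ≢ᵇ p)
≢ᵇ-sym zero    zero    = refl
≢ᵇ-sym zero    (suc q) = refl
≢ᵇ-sym (suc p) zero    = refl
≢ᵇ-sym (suc p) (suc q) = ≢ᵇ-sym p q

count-separates-sym : (G : Graph n) (s : Fin n → Bool) (x y : Fin n) →
  count (λ z → s z ∧ separates G x y z) ≡ count (λ z → s z ∧ separates G y x z)
count-separates-sym G s x y = count-cong λ z → cong (s z ∧_) (≢ᵇ-sym (d₂ G x z) (d₂ G y z))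

-- Also true for z = x; in G + H this is exactly when z separates x from any vertex across the join.
nonNeighbour : Graph n → Fin n → Fin n → Bool
nonNeighbour G x z = d₂ G x z ≢ᵇ 1

nonNeighbour-self : (G : Graph n) (x : Fin n) → T (nonNeighbour G x x)
nonNeighbour-self G x rewrite d₂-self G x = _

¬T-∧-false : ∀ a {b} → b ≡ false → ¬ T (a ∧ b)
¬T-∧-false a refl rewrite ∧-zeroʳ a = λ ()

data JoinView (m : ℕ) {n : ℕ} : Fin (m + n) → Set where
  inl : (i : Fin m) → JoinView m (i ↑ˡ n)
  inr : (j : Fin n) → JoinView m (m ↑ʳ j)

joinView : ∀ m {n} (X : Fin (m + n)) → JoinView m X
joinView m X with splitAt m X in eq
... | inj₁ i = subst (JoinView m) (splitAt⁻¹-↑ˡ eq) (inl i)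
... | inj₂ j = subst (JoinView m) (splitAt⁻¹-↑ʳ eq) (inr j)

module _ (G : Graph m) (H : Graph n) where

  ↑ˡ≢↑ʳ : (x : Fin m) (y : Fin n) → x ↑ˡ n ≢ m ↑ʳ y
  ↑ˡ≢↑ʳ x y eq with () ← trans (sym (splitAt-↑ˡ m x n)) (trans (cong (splitAt m) eq) (splitAt-↑ʳ m n y))

  adj-⊹ˡ : ∀ x y → adj (G ⊹ H) (x ↑ˡ n) (y ↑ˡ n) ≡ adj G x y
  adj-⊹ˡ x y rewrite splitAt-↑ˡ m x n | splitAt-↑ˡ m y n = refl

  adj-⊹ʳ : ∀ x y → adj (G ⊹ H) (m ↑ʳ x) (m ↑ʳ y) ≡ adj H x y
  adj-⊹ʳ x y rewrite splitAt-↑ʳ m n x | splitAt-↑ʳ m n y = refl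

  adj-⊹ˡʳ : ∀ x y → adj (G ⊹ H) (x ↑ˡ n) (m ↑ʳ y) ≡ true
  adj-⊹ˡʳ x y rewrite splitAt-↑ˡ m x n | splitAt-↑ʳ m n y = refl

  adj-⊹ʳˡ : ∀ x y → adj (G ⊹ H) (m ↑ʳ y) (x ↑ˡ n) ≡ true
  adj-⊹ʳˡ x y rewrite splitAt-↑ˡ m x n | splitAt-↑ʳ m n y = refl

  d₂-⊹ˡ : ∀ x y → d₂ (G ⊹ H) (x ↑ˡ n) (y ↑ˡ n) ≡ d₂ G x y
  d₂-⊹ˡ = d₂-embedding G (G ⊹ H) (_↑ˡ n) (↑ˡ-injective n _ _) adj-⊹ˡ

  d₂-⊹ʳ : ∀ x y → d₂ (G ⊹ H) (m ↑ʳ x) (m ↑ʳ y) ≡ d₂ H x y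
  d₂-⊹ʳ = d₂-embedding H (G ⊹ H) (m ↑ʳ_) (↑ʳ-injective m _ _) adj-⊹ʳ

  d₂-⊹ˡʳ : ∀ x y → d₂ (G ⊹ H) (x ↑ˡ n) (m ↑ʳ y) ≡ 1
  d₂-⊹ˡʳ x y = trans (d₂-≢ (G ⊹ H) (↑ˡ≢↑ʳ x y)) (cong (if_then 1 else 2) (adj-⊹ˡʳ x y))

  d₂-⊹ʳˡ : ∀ x y → d₂ (G ⊹ H) (m ↑ʳ y) (x ↑ˡ n) ≡ 1
  d₂-⊹ʳˡ x y = trans (d₂-≢ (G ⊹ H) (↑ˡ≢↑ʳ x y ∘ sym))
                     (cong (if_then 1 else 2) (adj-⊹ʳˡ x y))

  module _ (s : Fin (m + n) → Bool) where
    count-separates-⊹ˡ : ∀ x y → count (λ z → s z ∧ separates (G ⊹ H) (x ↑ˡ n) (y ↑ˡ n) z)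
                                ≡ count (λ i → s (i ↑ˡ n) ∧ separates G x y i)
    count-separates-⊹ˡ x y = trans (count-+ m _) (trans
      (cong₂ _+_ (count-cong λ i → cong (s (i ↑ˡ n) ∧_) (cong₂ _≢ᵇ_ (d₂-⊹ˡ x i) (d₂-⊹ˡ y i)))
                 (count-≡0 λ j → ¬T-∧-false _ (cong₂ _≢ᵇ_ (d₂-⊹ˡʳ x j) (d₂-⊹ˡʳ y j))))
      (+-identityʳ _))

    count-separates-⊹ʳ : ∀ x y → count (λ z → s z ∧ separates (G ⊹ H) (m ↑ʳ x) (m ↑ʳ y) z)
                                ≡ count (λ j → s (m ↑ʳ j) ∧ separates H x y j)
    count-separates-⊹ʳ x y = trans (count-+ m _)
      (cong₂ _+_ (count-≡0 λ i → ¬T-∧-false _ (cong₂ _≢ᵇ_ (d₂-⊹ʳˡ i x) (d₂-⊹ʳˡ i y)))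
                 (count-cong λ j → cong (s (m ↑ʳ j) ∧_) (cong₂ _≢ᵇ_ (d₂-⊹ʳ x j) (d₂-⊹ʳ y j))))

    count-separates-⊹ˡʳ : ∀ x y → count (λ z → s z ∧ separates (G ⊹ H) (x ↑ˡ n) (m ↑ʳ y) z)
                                 ≡ count (λ i → s (i ↑ˡ n) ∧ nonNeighbour G x i)
                                   + count (λ j → s (m ↑ʳ j) ∧ nonNeighbour H y j)
    count-separates-⊹ˡʳ x y = trans (count-+ m _)
      (cong₂ _+_ (count-cong λ i → cong (s (i ↑ˡ n) ∧_) (cong₂ _≢ᵇ_ (d₂-⊹ˡ x i) (d₂-⊹ʳˡ i y)))
                 (count-cong λ j → cong (s (m ↑ʳ j) ∧_)
                   (trans (cong₂ _≢ᵇ_ (d₂-⊹ˡʳ x j) (d₂-⊹ʳ y j)) (≢ᵇ-sym 1 (d₂ H y j)))))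

    isAdjGen-⊹⇒ˡ : IsAdjGenᶠ k (G ⊹ H) s → IsAdjGenᶠ k G (s ∘ (_↑ˡ n))
    isAdjGen-⊹⇒ˡ {k} gen x y x≢y =
      subst (k ≤_) (count-separates-⊹ˡ x y) (gen _ _ (x≢y ∘ ↑ˡ-injective n x y))

    isAdjGen-⊹⇒ʳ : IsAdjGenᶠ k (G ⊹ H) s → IsAdjGenᶠ k H (s ∘ (m ↑ʳ_))
    isAdjGen-⊹⇒ʳ {k} gen x y x≢y =
      subst (k ≤_) (count-separates-⊹ʳ x y) (gen _ _ (x≢y ∘ ↑ʳ-injective m x y))

  module _ (f : Fin m → Bool) (g : Fin n → Bool) where

    count-⊕ˡ : (h : Fin m → Bool) → count (λ i → (f ⊕ g) (i ↑ˡ n) ∧ h i) ≡ count (λ i → f i ∧ h i)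
    count-⊕ˡ h = count-cong λ i → cong (_∧ h i) (⊕-↑ˡ f g i)

    count-⊕ʳ : (h : Fin n → Bool) → count (λ j → (f ⊕ g) (m ↑ʳ j) ∧ h j) ≡ count (λ j → g j ∧ h j)
    count-⊕ʳ h = count-cong λ j → cong (_∧ h j) (⊕-↑ʳ f g j)

    count-separates-⊕ˡʳ : ∀ x y → count (λ z → (f ⊕ g) z ∧ separates (G ⊹ H) (x ↑ˡ n) (m ↑ʳ y) z)
                                 ≡ count (λ i → f i ∧ nonNeighbour G x i)
                                   + count (λ j → g j ∧ nonNeighbour H y j)
    count-separates-⊕ˡʳ x y =
      trans (count-separates-⊹ˡʳ (f ⊕ g) x y) (cong₂ _+_ (count-⊕ˡ _) (count-⊕ʳ _))

    isAdjGen-⊕ : IsAdjGenᶠ k G f → IsAdjGenᶠ k H g →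
                 (∀ x y → k ≤ count (λ i → f i ∧ nonNeighbour G x i)
                                + count (λ j → g j ∧ nonNeighbour H y j)) →
                 IsAdjGenᶠ k (G ⊹ H) (f ⊕ g)
    isAdjGen-⊕ {k} genG genH genGH X Y X≢Y with joinView m X | joinView m Y
    ... | inl x | inl y = subst (k ≤_) (sym (trans (count-separates-⊹ˡ (f ⊕ g) x y) (count-⊕ˡ _)))
                                (genG x y (X≢Y ∘ cong (_↑ˡ n)))
    ... | inr x | inr y = subst (k ≤_) (sym (trans (count-separates-⊹ʳ (f ⊕ g) x y) (count-⊕ʳ _)))
                                (genH x y (X≢Y ∘ cong (m ↑ʳ_)))
    ... | inl x | inr y = subst (k ≤_) (sym (count-separates-⊕ˡʳ x y)) (genGH x y)
    ... | inr x | inl y =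
      subst (k ≤_) (sym (trans (count-separates-sym (G ⊹ H) (f ⊕ g) (m ↑ʳ x) (y ↑ˡ n))
                               (count-separates-⊕ˡʳ y x)))
            (genGH y x)

adim-⊹-≥ : (G : Graph m) (H : Graph n) → k ≤ 𝒞min (G ⊹ H) → adim k G + adim k H ≤ adim k (G ⊹ H)
adim-⊹-≥ {m} {n} {k} G H k≤𝒞 with adim-attained (G ⊹ H) k≤𝒞
... | s , gen , count≡adim = begin
  adim k G + adim k H                       ≤⟨ +-mono-≤ (adim-≤-count G (isAdjGen-⊹⇒ˡ G H s gen))
                                                        (adim-≤-count H (isAdjGen-⊹⇒ʳ G H s gen)) ⟩
  count (s ∘ (_↑ˡ n)) + count (s ∘ (m ↑ʳ_)) ≡⟨ count-+ m s ⟨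
  count s                                   ≡⟨ count≡adim ⟩
  adim k (G ⊹ H)                            ∎
  where open ≤-Reasoning

AdjacentToAll : Graph n → (Fin n → Bool) → Fin n → Set
AdjacentToAll G s y = ∀ z → T (s z) → d₂ G y z ≡ 1

adjacentToAll? : (G : Graph n) (s : Fin n → Bool) (y : Fin n) → Dec (AdjacentToAll G s y)
adjacentToAll? G s y = all? λ z → T? (s z) →-dec d₂ G y z ℕ.≟ 1

adjacentToAll-unique : (G : Graph n) (s : Fin n → Bool) → 1 ≤ k → IsAdjGenᶠ k G s →
                       ∀ {w y} → AdjacentToAll G s w → AdjacentToAll G s y → w ≡ y
adjacentToAll-unique {k = k} G s 1≤k gen {w} {y} adj-w adj-y with w ≟ y
... | yes w≡y = w≡y
... | no  w≢y = contradiction (≤-trans 1≤k (subst (k ≤_) (count-≡0 unseparated) (gen w y w≢y))) λ ()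
  where
    unseparated : ∀ z → ¬ T (s z ∧ separates G w y z)
    unseparated z sz∧sep =
      let (sz , sep) = to T-∧ sz∧sep in subst T (cong₂ _≢ᵇ_ (adj-w z sz) (adj-y z sz)) sep

¬adjacentToAll⇒nonNeighbour : (G : Graph n) (s : Fin n → Bool) {y : Fin n} →
                              ¬ AdjacentToAll G s y → 1 ≤ count (λ z → s z ∧ nonNeighbour G y z)
¬adjacentToAll⇒nonNeighbour {n} G s {y} ¬adj
  with z , ¬adj-z ← ¬∀⟶∃¬ n _ (λ z → T? (s z) →-dec d₂ G y z ℕ.≟ 1) ¬adj =
  count-pos z (from T-∧ ( decidable-stable (T? (s z)) (λ ¬sz → ¬adj-z (⊥-elim ∘ ¬sz))
                         , from T-not-≡ (dec-false (d₂ G y z ℕ.≟ 1) (λ d≡1 → ¬adj-z (λ _ → d≡1)))))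

-- The summand boolToℕ (s zero) is the apex separating itself from x.
isAdjGen-K₁⊹-apex : (G : Graph m) (s : Fin (suc m) → Bool) → IsAdjGenᶠ k (K₁ ⊹ G) s →
                    ∀ x → k ≤ boolToℕ (s zero) + count (λ i → s (suc i) ∧ nonNeighbour G x i)
isAdjGen-K₁⊹-apex {k = k} G s gen x = subst (k ≤_) count≡ (gen zero (suc x) λ ())
  where
    rest : ℕ
    rest = count (λ i → s (suc i) ∧ nonNeighbour G x i)
    count≡ : count (λ z → s z ∧ separates (K₁ ⊹ G) zero (suc x) z) ≡ boolToℕ (s zero) + rest
    count≡ = trans (count-separates-⊹ˡʳ K₁ G s zero x)
                   (cong (_+ rest) (trans (+-identityʳ _) (cong boolToℕ (∧-identityʳ (s zero)))))

boolToℕ-+-≤ : ∀ b {a c} → (T b → 1 ≤ c) → boolToℕ b + a ≤ a + c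
boolToℕ-+-≤ false         _   = m≤m+n _ _
boolToℕ-+-≤ true  {a} {c} 1≤c = ≤-trans (+-monoˡ-≤ a (1≤c _)) (≤-reflexive (+-comm c a))

module JoinGenerator (G : Graph m) (H : Graph n) (1≤k : 1 ≤ k)
         (s₁ : Fin (suc m) → Bool) (gen₁ : IsAdjGenᶠ k (K₁ ⊹ G) s₁)
         (s₂ : Fin n → Bool) (gen₂ : IsAdjGenᶠ k H s₂) where

  -- The replacement for the apex of K₁ + G: at most one vertex, by adjacentToAll-unique.
  extra : Fin n → Bool
  extra y = s₁ zero ∧ isYes (adjacentToAll? H s₂ y)

  s₂⁺ : Fin n → Bool
  s₂⁺ y = extra y ∨ s₂ y

  s₂⁺-nonNeighbour : ∀ y → T (s₁ zero) → 1 ≤ count (λ j → s₂⁺ j ∧ nonNeighbour H y j)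
  s₂⁺-nonNeighbour y apex with adjacentToAll? H s₂ y
  ... | yes adj-y = count-pos y (from T-∧ (from T-∨ (inj₁ (from T-∧ (apex , fromWitness adj-y)))
                                      , nonNeighbour-self H y))
  ... | no ¬adj = ≤-trans (¬adjacentToAll⇒nonNeighbour H s₂ {y} ¬adj) (count-mono λ j sj∧ →
                    let (sj , nn) = to T-∧ sj∧ in from T-∧ (from (T-∨ {extra j}) (inj₂ sj) , nn))

  joinGen-isAdjGen : IsAdjGenᶠ k (G ⊹ H) ((s₁ ∘ suc) ⊕ s₂⁺)
  joinGen-isAdjGen =
    isAdjGen-⊕ G H (s₁ ∘ suc) s₂⁺
      (isAdjGen-⊹⇒ʳ K₁ G s₁ gen₁)
      (isAdjGenᶠ-mono H {s₂} (λ j → from (T-∨ {extra j}) ∘ inj₂) gen₂)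
      λ x y → ≤-trans (isAdjGen-K₁⊹-apex G s₁ gen₁ x) (boolToℕ-+-≤ (s₁ zero) (s₂⁺-nonNeighbour y))

  count-extra : count extra ≤ boolToℕ (s₁ zero)
  count-extra =
    count-∧ˡ (s₁ zero) {λ y → isYes (adjacentToAll? H s₂ y)} λ _ → count-≤1 λ w y w⁺ y⁺ →
      adjacentToAll-unique H s₂ 1≤k gen₂ (toWitness {a? = adjacentToAll? H s₂ w} w⁺)
                                         (toWitness {a? = adjacentToAll? H s₂ y} y⁺)

  count-joinGen : count ((s₁ ∘ suc) ⊕ s₂⁺) ≤ count s₁ + count s₂
  count-joinGen = begin
    count ((s₁ ∘ suc) ⊕ s₂⁺)            ≡⟨ count-⊕ (s₁ ∘ suc) s₂⁺ ⟩
    c + count s₂⁺                       ≤⟨ +-monoʳ-≤ c (count-∨ extra s₂) ⟩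
    c + (count extra + count s₂)        ≤⟨ +-monoʳ-≤ c (+-monoˡ-≤ (count s₂) count-extra) ⟩
    c + (boolToℕ (s₁ zero) + count s₂)  ≡⟨ +-assoc c _ _ ⟨
    c + boolToℕ (s₁ zero) + count s₂    ≡⟨ cong (_+ count s₂) (+-comm c _) ⟩
    boolToℕ (s₁ zero) + c + count s₂    ∎
    where
      open ≤-Reasoning
      c : ℕ
      c = count (s₁ ∘ suc)

adim-⊹-≤ : (G : Graph m) (H : Graph n) → 1 ≤ k → k ≤ 𝒞min (K₁ ⊹ G) → k ≤ 𝒞min H →
           adim k (G ⊹ H) ≤ adim k (K₁ ⊹ G) + adim k H
adim-⊹-≤ {k = k} G H 1≤k k≤𝒞₁ k≤𝒞₂ with adim-attained (K₁ ⊹ G) k≤𝒞₁ | adim-attained H k≤𝒞₂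
... | s₁ , gen₁ , count≡adim₁ | s₂ , gen₂ , count≡adim₂ =
  begin
    adim k (G ⊹ H)             ≤⟨ adim-≤-count (G ⊹ H) joinGen-isAdjGen ⟩
    count ((s₁ ∘ suc) ⊕ s₂⁺)   ≤⟨ count-joinGen ⟩
    count s₁ + count s₂        ≡⟨ cong₂ _+_ count≡adim₁ count≡adim₂ ⟩
    adim k (K₁ ⊹ G) + adim k H ∎
  where
    open ≤-Reasoning
    open JoinGenerator G H 1≤k s₁ gen₁ s₂ gen₂

theorem44 : ∀ {m n} (G : Graph m) (H : Graph n) → 2 ≤ m → 2 ≤ n →
    (∀ k → 1 ≤ k → k ≤ 𝒞min (G ⊹ H) →
      adim k G + adim k H ≤ adim k (G ⊹ H))
    × (∀ k → 1 ≤ k → k ≤ 𝒞min H ⊓ 𝒞min (K₁ ⊹ G) →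
      adim k (G ⊹ H) ≤ adim k (K₁ ⊹ G) + adim k H)
theorem44 G H _ _ =
    (λ k _ k≤𝒞 → adim-⊹-≥ G H k≤𝒞)
  , (λ k 1≤k k≤𝒞 → adim-⊹-≤ G H 1≤k (≤-trans k≤𝒞 (m⊓n≤n _ _)) (≤-trans k≤𝒞 (m⊓n≤m _ _)))
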